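{- Let $n>k$ be natural numbers, write $n=ki+t$ with integers $i\geqslant 1$ and $1\leqslant t\leqslant k$, and let $G$ be a graph on $n$ vertices with $h_k(G)<f_0(n,k)$. Partition the set $\{0,1,\dots,n-1\}$ into $i+1$ intervals of consecutive integers, each of size at most $k$. Then for every interval of this partition, $G$ contains at least $t$ vertices whose degree lies in that interval.
   Context: All graphs are finite, undirected, without loops or multiple edges. For a graph $G$ and a natural number $k$, $h_k(G)$ denotes the number of unordered pairs of distinct vertices of $G$ whose degrees differ by less than $k$. For natural numbers $n>k$, $$f_0(n,k):=\left(\left\lceil \tfrac{n}{k} \right\rceil - 2\right)\binom{k}{2} + \binom{k+1}{2} + \binom{n-k \left( \left\lceil\frac{n}{k} \right\rceil - 1 \right)-1}{2},$$ where $\binom{m}{2}=m(m-1)/2$. -}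

module Defs where

open import Data.Bool using (Bool; true; false; if_then_else_; _∧_)
open import Data.Nat using (ℕ; zero; suc; _+_; _*_; _∸_; _/_; _<_; _≤_; ∣_-_∣; NonZero)
open import Data.Nat.Properties using (_<?_)
open import Data.Fin using (Fin; toℕ)
open import Relation.Nullary.Decidable using (⌊_⌋)
open import Relation.Binary.PropositionalEquality using (_≡_)

record Graph (n : ℕ) : Set where
  field
    adj   : Fin n → Fin n → Bool
    sym   : ∀ u v → adj u v ≡ adj v u
    irrefl : ∀ v → adj v v ≡ false
open Graph public

count : ∀ {n} → (Fin n → Bool) → ℕ
count {zero}  p = 0
count {suc n} p = (if p Fin.zero then 1 else 0) + count (λ x → p (Fin.suc x))

sumFin : ∀ {n} → (Fin n → ℕ) → ℕ
sumFin {zero}  f = 0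
sumFin {suc n} f = f Fin.zero + sumFin (λ x → f (Fin.suc x))

degree : ∀ {n} → Graph n → Fin n → ℕ
degree G v = count (adj G v)

-- h_k(G): unordered pairs {u,v}, u ≠ v (counted once via toℕ u < toℕ v),
-- with |deg u - deg v| < k
h : ∀ {n} → ℕ → Graph n → ℕ
h k G = sumFin (λ u → count (λ v →
          ⌊ toℕ u <? toℕ v ⌋ ∧ ⌊ ∣ degree G u - degree G v ∣ <? k ⌋))

choose2 : ℕ → ℕ
choose2 m = (m * (m ∸ 1)) / 2

ceilDiv : ℕ → (k : ℕ) → .{{NonZero k}} → ℕ
ceilDiv n k = (n + (k ∸ 1)) / k

f0 : ℕ → (k : ℕ) → .{{NonZero k}} → ℕ
f0 n k = (ceilDiv n k ∸ 2) * choose2 k + choose2 (k + 1)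
         + choose2 (n ∸ k * (ceilDiv n k ∸ 1) ∸ 1)

{-# OPTIONS --safe #-}
-- Suppose the interval J contains the degrees of only s < t vertices. Classify the
-- vertices by the interval containing their degree: two vertices of one class have
-- degrees less than k apart, so h_k(G) is at least the sum of binom(N_j, 2) over the
-- class sizes N_j. The tangent-line bound binom(N, 2) ≥ kN − binom(k+1, 2) bounds the
-- part of this sum over the i classes other than J from below by
-- k(n − s) − i·binom(k+1, 2), and what remains, binom(s, 2) + k(n − s) − i·binom(k+1, 2),
-- decreases in s ≤ t − 1 ≤ k − 1; at s = t − 1 it equals f_0(n, k). Hence
-- h_k(G) ≥ f_0(n, k), a contradiction.
module Submission where

open import Defs
open import Data.Bool using (Bool)
open import Data.Nat using (ℕ; zero; suc; _+_; _*_; _∸_; _<_; _≤_; NonZero)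
open import Data.Nat.Properties using (_<?_; _≤?_)
open import Data.Fin using (Fin; fromℕ; inject₁)
open import Data.Bool using (_∧_)
open import Relation.Nullary.Decidable using (⌊_⌋)
open import Relation.Binary.PropositionalEquality using (_≡_)

open import Data.Bool using (true; false; if_then_else_; T)
open import Data.Bool.Properties using (T-∧)
open import Data.Nat using (z≤n; s≤s; _⊔_; ∣_-_∣)
open import Data.Nat.Properties
  using (≤-refl; ≤-trans; ≤-reflexive; <⇒≤; <⇒≱; ≤-pred; ≮⇒≥; <-≤-trans; m≤n⇒m≤1+n;
         +-comm; +-assoc; +-suc; +-identityʳ; *-zeroʳ; *-distribˡ-+; +-mono-≤; +-monoʳ-≤; +-monoˡ-≤;
         +-cancelˡ-≡; +-cancelʳ-≤; ∸-monoˡ-<; ⊔-lub; m+[n∸m]≡n; m+n∸m≡n;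
         ∣m+n-m+o∣≡∣n-o∣; ∣m-n∣≤m⊔n; +-*-semiring; module ≤-Reasoning)
open import Data.Nat.DivMod using (_/_; /-congˡ; +-distrib-/-∣ʳ; m*n/n≡m; m<n⇒m/n≡0)
open import Data.Nat.Divisibility using (n∣m*n)
open import Data.Nat.Tactic.RingSolver using (solve-∀)
open import Data.Fin using (toℕ; _≟_)
open import Data.Product using (∃-syntax; _×_; _,_; proj₁; proj₂)
open import Data.Empty using (⊥-elim)
open import Data.Unit using (tt)
open import Function using (_∘_; Equivalence)
open import Relation.Nullary using (yes; no)
open import Relation.Nullary.Decidable using (isYes≗does; ⌊⌋-map′; toWitness; fromWitness)
open import Relation.Binary.PropositionalEquality using (refl; trans; cong; cong₂; subst)
import Relation.Binary.PropositionalEquality as ≡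
open import Algebra.Properties.Semiring.Sum +-*-semiring
  using (sum; sum-cong-≗; sum-remove; sum-replicate-zero; ∑-distrib-+)
open import Data.Vec.Functional using (removeAt)

choose2-suc : ∀ m → choose2 (suc m) ≡ m + choose2 m
choose2-suc zero    = refl
choose2-suc (suc m) = begin
  suc (suc m) * suc m / 2          ≡⟨ /-congˡ (expand m) ⟩
  (suc m * m + suc m * 2) / 2      ≡⟨ +-distrib-/-∣ʳ (suc m * m) (n∣m*n (suc m)) ⟩
  choose2 (suc m) + suc m * 2 / 2  ≡⟨ cong (choose2 (suc m) +_) (m*n/n≡m (suc m) 2) ⟩
  choose2 (suc m) + suc m          ≡⟨ +-comm (choose2 (suc m)) (suc m) ⟩
  suc m + choose2 (suc m)          ∎
  where
  open ≡.≡-Reasoning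
  expand : ∀ m → suc (suc m) * suc m ≡ suc m * m + suc m * 2
  expand = solve-∀

2*choose2[m]+m≡m*m : ∀ m → 2 * choose2 m + m ≡ m * m
2*choose2[m]+m≡m*m zero    = refl
2*choose2[m]+m≡m*m (suc m) = begin
  2 * choose2 (suc m) + suc m        ≡⟨ cong (λ c → 2 * c + suc m) (choose2-suc m) ⟩
  2 * (m + choose2 m) + suc m        ≡⟨ regroup m (choose2 m) ⟩
  (2 * choose2 m + m) + suc (m + m)  ≡⟨ cong (_+ suc (m + m)) (2*choose2[m]+m≡m*m m) ⟩
  m * m + suc (m + m)                ≡⟨ square m ⟩
  suc m * suc m                      ∎
  where
  open ≡.≡-Reasoning
  regroup : ∀ m c → 2 * (m + c) + suc m ≡ (2 * c + m) + suc (m + m)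
  regroup = solve-∀
  square : ∀ m → m * m + suc (m + m) ≡ suc m * suc m
  square = solve-∀

-- The increments choose2 (j + 1) ∸ choose2 j = j stay below k.
choose2[m+d]≤choose2[m]+k*d : ∀ {k} m d → m + d ≤ k → choose2 (m + d) ≤ choose2 m + k * d
choose2[m+d]≤choose2[m]+k*d {k} m zero _
  rewrite +-identityʳ m | *-zeroʳ k | +-identityʳ (choose2 m) = ≤-refl
choose2[m+d]≤choose2[m]+k*d {k} m (suc d) m+1+d≤k = begin
  choose2 (m + suc d)      ≡⟨ cong choose2 (+-suc m d) ⟩
  choose2 (suc (m + d))    ≡⟨ choose2-suc (m + d) ⟩
  m + d + choose2 (m + d)  ≤⟨ +-mono-≤ (<⇒≤ m+d<k) (choose2[m+d]≤choose2[m]+k*d m d (<⇒≤ m+d<k)) ⟩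
  k + (choose2 m + k * d)  ≡⟨ regroup k (choose2 m) d ⟩
  choose2 m + k * suc d    ∎
  where
  open ≤-Reasoning
  m+d<k : m + d < k
  m+d<k = subst (_≤ k) (+-suc m d) m+1+d≤k
  regroup : ∀ k c d → k + (c + k * d) ≡ c + k * suc d
  regroup = solve-∀

-- The line through the points m = k and m = k + 1 of the convex m ↦ binom(m, 2) has
-- slope k and lies below it.
k*m≤choose2[m]+choose2[1+k] : ∀ k m → k * m ≤ choose2 m + choose2 (suc k)
k*m≤choose2[m]+choose2[1+k] k       zero    = ≤-trans (≤-reflexive (*-zeroʳ k)) z≤n
k*m≤choose2[m]+choose2[1+k] zero    (suc m) = z≤n
k*m≤choose2[m]+choose2[1+k] (suc k) (suc m) = begin
  suc k * suc m                                 ≡⟨ expand k m ⟩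
  suc (k + m) + k * m                           ≤⟨ +-monoʳ-≤ (suc (k + m)) (k*m≤choose2[m]+choose2[1+k] k m) ⟩
  suc (k + m) + (choose2 m + choose2 (suc k))   ≡⟨ regroup k m (choose2 m) (choose2 (suc k)) ⟩
  (m + choose2 m) + (suc k + choose2 (suc k))   ≡⟨ ≡.sym (cong₂ _+_ (choose2-suc m) (choose2-suc (suc k))) ⟩
  choose2 (suc m) + choose2 (suc (suc k))       ∎
  where
  open ≤-Reasoning
  expand : ∀ k m → suc k * suc m ≡ suc (k + m) + k * m
  expand = solve-∀
  regroup : ∀ k m c c′ → suc (k + m) + (c + c′) ≡ (m + c) + (suc k + c′)
  regroup = solve-∀

ceilDiv[k*i+1+t]≡1+i : ∀ k i t → t < suc k → ceilDiv (suc k * i + suc t) (suc k) ≡ suc i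
ceilDiv[k*i+1+t]≡1+i k i t t<k = begin
  (suc k * i + suc t + k) / suc k                ≡⟨ /-congˡ (regroup k i t) ⟩
  (t + suc i * suc k) / suc k                    ≡⟨ +-distrib-/-∣ʳ t (n∣m*n (suc i)) ⟩
  t / suc k + suc i * suc k / suc k              ≡⟨ cong₂ _+_ (m<n⇒m/n≡0 t<k) (m*n/n≡m (suc i) (suc k)) ⟩
  suc i                                          ∎
  where
  open ≡.≡-Reasoning
  regroup : ∀ k i t → suc k * i + suc t + k ≡ t + suc i * suc k
  regroup = solve-∀

f0-closed : ∀ k i t → t < suc k →
  f0 (suc k * suc i + suc t) (suc k) ≡ suc i * choose2 (suc k) + suc k + choose2 t
f0-closed k i t t<k = begin
  f0-at (ceilDiv n (suc k))
    ≡⟨ cong f0-at (ceilDiv[k*i+1+t]≡1+i k (suc i) t t<k) ⟩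
  i * K + choose2 (suc k + 1) + choose2 (n ∸ suc k * suc i ∸ 1)
    ≡⟨ cong (λ m → i * K + choose2 (suc k + 1) + choose2 (m ∸ 1)) (m+n∸m≡n (suc k * suc i) (suc t)) ⟩
  i * K + choose2 (suc k + 1) + choose2 t
    ≡⟨ cong (λ c → i * K + c + choose2 t) (trans (cong choose2 (+-comm (suc k) 1)) (choose2-suc (suc k))) ⟩
  i * K + (suc k + K) + choose2 t
    ≡⟨ regroup i K (suc k) (choose2 t) ⟩
  suc i * K + suc k + choose2 t
    ∎
  where
  open ≡.≡-Reasoning
  n = suc k * suc i + suc t
  K = choose2 (suc k)
  f0-at : ℕ → ℕ
  f0-at c = (c ∸ 2) * K + choose2 (suc k + 1) + choose2 (n ∸ suc k * (c ∸ 1) ∸ 1)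
  regroup : ∀ i K k c → i * K + (k + K) + c ≡ suc i * K + k + c
  regroup = solve-∀

-- s is the size of one class, X and Y are the sums of the sizes and of binom(size, 2)
-- over the other i classes. Both sides are raised by i·binom(k+1, 2) so that no
-- subtraction occurs.
f0-closed≤choose2[s]+Y : ∀ k i t s X Y → s ≤ t → t < k → s + X ≡ k * i + suc t →
  k * X ≤ Y + i * choose2 (suc k) →
  i * choose2 k + k + choose2 t ≤ choose2 s + Y
f0-closed≤choose2[s]+Y k i t s X Y s≤t t<k s+X≡n kX≤ = +-cancelʳ-≤ (i * choose2 (suc k)) _ _ (begin
  i * K + k + choose2 t + i * choose2 (suc k)
    ≡⟨ cong₂ (λ c c′ → i * K + k + choose2 c + i * c′) t≡s+d (choose2-suc k) ⟩
  i * K + k + choose2 (s + d) + i * (k + K)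
    ≤⟨ +-monoˡ-≤ (i * (k + K)) (+-monoʳ-≤ (i * K + k)
         (choose2[m+d]≤choose2[m]+k*d s d (≤-trans (≤-reflexive (≡.sym t≡s+d)) (<⇒≤ t<k)))) ⟩
  i * K + k + (choose2 s + k * d) + i * (k + K)
    ≡⟨ regroup₁ i K k (choose2 s) d ⟩
  choose2 s + ((2 * K + k) * i + k * suc d)
    ≡⟨ cong (λ q → choose2 s + (q * i + k * suc d)) (2*choose2[m]+m≡m*m k) ⟩
  choose2 s + (k * k * i + k * suc d)
    ≡⟨ regroup₂ (choose2 s) k i d ⟩
  choose2 s + k * (k * i + suc d)
    ≡⟨ cong (λ x → choose2 s + k * x) (≡.sym X≡) ⟩
  choose2 s + k * X
    ≤⟨ +-monoʳ-≤ (choose2 s) kX≤ ⟩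
  choose2 s + (Y + i * choose2 (suc k))
    ≡⟨ ≡.sym (+-assoc (choose2 s) Y _) ⟩
  choose2 s + Y + i * choose2 (suc k)
    ∎)
  where
  open ≤-Reasoning
  K = choose2 k
  d = t ∸ s
  t≡s+d : t ≡ s + d
  t≡s+d = ≡.sym (m+[n∸m]≡n s≤t)
  X≡ : X ≡ k * i + suc d
  X≡ = +-cancelˡ-≡ s _ _ (trans s+X≡n (trans (cong (λ u → k * i + suc u) t≡s+d) (shift k i s d)))
    where
    shift : ∀ k i s d → k * i + suc (s + d) ≡ s + (k * i + suc d)
    shift = solve-∀
  regroup₁ : ∀ i K k c d → i * K + k + (c + k * d) + i * (k + K) ≡ c + ((2 * K + k) * i + k * suc d)
  regroup₁ = solve-∀
  regroup₂ : ∀ c k i d → c + (k * k * i + k * suc d) ≡ c + k * (k * i + suc d)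
  regroup₂ = solve-∀

count-cong : ∀ {n} {p q : Fin n → Bool} → (∀ x → p x ≡ q x) → count p ≡ count q
count-cong {zero}  p≗q = refl
count-cong {suc n} p≗q =
  cong₂ _+_ (cong (λ b → if b then 1 else 0) (p≗q Fin.zero)) (count-cong (p≗q ∘ Fin.suc))

count-mono : ∀ {n} {p q : Fin n → Bool} → (∀ x → T (p x) → T (q x)) → count p ≤ count q
count-mono {zero}          p⇒q = z≤n
count-mono {suc n} {p} {q} p⇒q with p Fin.zero | q Fin.zero | p⇒q Fin.zero
... | true  | true  | _    = s≤s (count-mono (p⇒q ∘ Fin.suc))
... | true  | false | p⇏q  = ⊥-elim (p⇏q tt)
... | false | true  | _    = m≤n⇒m≤1+n (count-mono (p⇒q ∘ Fin.suc))
... | false | false | _    = count-mono (p⇒q ∘ Fin.suc)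

count≤n : ∀ {n} (p : Fin n → Bool) → count p ≤ n
count≤n {zero}  p = z≤n
count≤n {suc n} p with p Fin.zero
... | true  = s≤s (count≤n (p ∘ Fin.suc))
... | false = m≤n⇒m≤1+n (count≤n (p ∘ Fin.suc))

count<n : ∀ {n} (p : Fin n → Bool) x → p x ≡ false → count p < n
count<n {suc n} p Fin.zero    px≡false rewrite px≡false = s≤s (count≤n (p ∘ Fin.suc))
count<n {suc n} p (Fin.suc x) px≡false with p Fin.zero
... | true  = s≤s (count<n (p ∘ Fin.suc) x px≡false)
... | false = m≤n⇒m≤1+n (count<n (p ∘ Fin.suc) x px≡false)

degree<n : ∀ {n} (G : Graph n) v → degree G v < n
degree<n G v = count<n (adj G v) v (irrefl G v)

sumFin≡sum : ∀ {n} (f : Fin n → ℕ) → sumFin f ≡ sum f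
sumFin≡sum {zero}  f = refl
sumFin≡sum {suc n} f = cong (f Fin.zero +_) (sumFin≡sum (f ∘ Fin.suc))

sum-mono : ∀ {n} {f g : Fin n → ℕ} → (∀ x → f x ≤ g x) → sum f ≤ sum g
sum-mono {zero}  f≤g = z≤n
sum-mono {suc n} f≤g = +-mono-≤ (f≤g Fin.zero) (sum-mono (f≤g ∘ Fin.suc))

k*sum≤sum-choose2+m*choose2[1+k] : ∀ k {m} (f : Fin m → ℕ) →
  k * sum f ≤ sum (choose2 ∘ f) + m * choose2 (suc k)
k*sum≤sum-choose2+m*choose2[1+k] k {zero}  f = ≤-reflexive (*-zeroʳ k)
k*sum≤sum-choose2+m*choose2[1+k] k {suc m} f = begin
  k * (f Fin.zero + sum (f ∘ Fin.suc))
    ≡⟨ *-distribˡ-+ k (f Fin.zero) _ ⟩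
  k * f Fin.zero + k * sum (f ∘ Fin.suc)
    ≤⟨ +-mono-≤ (k*m≤choose2[m]+choose2[1+k] k (f Fin.zero))
                (k*sum≤sum-choose2+m*choose2[1+k] k (f ∘ Fin.suc)) ⟩
  (choose2 (f Fin.zero) + choose2 (suc k)) + (sum (choose2 ∘ f ∘ Fin.suc) + m * choose2 (suc k))
    ≡⟨ regroup (choose2 (f Fin.zero)) (choose2 (suc k)) _ m ⟩
  sum (choose2 ∘ f) + suc m * choose2 (suc k)
    ∎
  where
  open ≤-Reasoning
  regroup : ∀ a c s m → (a + c) + (s + m * c) ≡ (a + s) + suc m * c
  regroup = solve-∀

⌊suc<?suc⌋ : ∀ a b → ⌊ suc a <? suc b ⌋ ≡ ⌊ a <? b ⌋
⌊suc<?suc⌋ a b = trans (isYes≗does _) (≡.sym (isYes≗does _))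

∧-monoʳ : ∀ {a b c} → (T b → T c) → T (a ∧ b) → T (a ∧ c)
∧-monoʳ {true} b⇒c = b⇒c

pairsWith : ∀ {n} → (Fin n → Fin n → Bool) → ℕ
pairsWith c = sum (λ u → count (λ v → ⌊ toℕ u <? toℕ v ⌋ ∧ c u v))

h≡pairsWith : ∀ {n} k (G : Graph n) →
  h k G ≡ pairsWith (λ u v → ⌊ ∣ degree G u - degree G v ∣ <? k ⌋)
h≡pairsWith k G =
  sumFin≡sum (λ u → count (λ v → ⌊ toℕ u <? toℕ v ⌋ ∧ ⌊ ∣ degree G u - degree G v ∣ <? k ⌋))

pairsWith-suc : ∀ {n} (c : Fin (suc n) → Fin (suc n) → Bool) →
  pairsWith c ≡ count (λ v → c Fin.zero (Fin.suc v)) + pairsWith (λ u v → c (Fin.suc u) (Fin.suc v))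
pairsWith-suc c = cong (count (λ v → c Fin.zero (Fin.suc v)) +_) (sum-cong-≗ λ u → count-cong λ v →
  cong (_∧ c (Fin.suc u) (Fin.suc v)) (⌊suc<?suc⌋ (toℕ u) (toℕ v)))

pairsWith-mono : ∀ {n} {c c′ : Fin n → Fin n → Bool} →
  (∀ u v → T (c u v) → T (c′ u v)) → pairsWith c ≤ pairsWith c′
pairsWith-mono c⇒c′ = sum-mono λ u → count-mono λ v → ∧-monoʳ (c⇒c′ u v)

classSize : ∀ {n m} → (Fin n → Fin m) → Fin m → ℕ
classSize cl j = count (λ v → ⌊ cl v ≟ j ⌋)

indicator : ∀ {m} → Fin m → Fin m → ℕ
indicator x j = if ⌊ x ≟ j ⌋ then 1 else 0

indicator-suc : ∀ {m} (x j : Fin m) → indicator (Fin.suc x) (Fin.suc j) ≡ indicator x j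
indicator-suc x j = cong (λ b → if b then 1 else 0) (⌊⌋-map′ _ _ (x ≟ j))

sum-indicator : ∀ {m} (x : Fin m) → sum (indicator x) ≡ 1
sum-indicator {suc m} Fin.zero    = cong suc (sum-replicate-zero m)
sum-indicator {suc m} (Fin.suc x) = trans (sum-cong-≗ (indicator-suc x)) (sum-indicator x)

sum-choose2-bump : ∀ {m} (x : Fin m) (N : Fin m → ℕ) →
  sum (λ j → choose2 (indicator x j + N j)) ≡ sum (choose2 ∘ N) + N x
sum-choose2-bump {suc m} Fin.zero N = begin
  choose2 (suc (N Fin.zero)) + sum (choose2 ∘ N ∘ Fin.suc)
    ≡⟨ cong (_+ sum (choose2 ∘ N ∘ Fin.suc)) (choose2-suc (N Fin.zero)) ⟩
  N Fin.zero + choose2 (N Fin.zero) + sum (choose2 ∘ N ∘ Fin.suc)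
    ≡⟨ regroup (N Fin.zero) _ _ ⟩
  sum (choose2 ∘ N) + N Fin.zero
    ∎
  where
  open ≡.≡-Reasoning
  regroup : ∀ a c s → a + c + s ≡ c + s + a
  regroup = solve-∀
sum-choose2-bump {suc m} (Fin.suc x) N = begin
  choose2 (N Fin.zero) + sum (λ j → choose2 (indicator (Fin.suc x) (Fin.suc j) + N (Fin.suc j)))
    ≡⟨ cong (choose2 (N Fin.zero) +_) (sum-cong-≗ λ j →
         cong (λ a → choose2 (a + N (Fin.suc j))) (indicator-suc x j)) ⟩
  choose2 (N Fin.zero) + sum (λ j → choose2 (indicator x j + N (Fin.suc j)))
    ≡⟨ cong (choose2 (N Fin.zero) +_) (sum-choose2-bump x (N ∘ Fin.suc)) ⟩
  choose2 (N Fin.zero) + (sum (choose2 ∘ N ∘ Fin.suc) + N (Fin.suc x))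
    ≡⟨ ≡.sym (+-assoc (choose2 (N Fin.zero)) _ _) ⟩
  sum (choose2 ∘ N) + N (Fin.suc x)
    ∎
  where open ≡.≡-Reasoning

sum-classSize : ∀ {n m} (cl : Fin n → Fin m) → sum (classSize cl) ≡ n
sum-classSize {zero}  {m} cl = sum-replicate-zero m
sum-classSize {suc n}     cl = begin
  sum (λ j → indicator (cl Fin.zero) j + classSize (cl ∘ Fin.suc) j)
    ≡⟨ ∑-distrib-+ (indicator (cl Fin.zero)) (classSize (cl ∘ Fin.suc)) ⟩
  sum (indicator (cl Fin.zero)) + sum (classSize (cl ∘ Fin.suc))
    ≡⟨ cong₂ _+_ (sum-indicator (cl Fin.zero)) (sum-classSize (cl ∘ Fin.suc)) ⟩
  suc n
    ∎
  where open ≡.≡-Reasoning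

-- Comparing cl v with cl u (not the reverse) makes the row u = 0 of the pair count
-- definitionally the class size of cl 0 among the remaining vertices.
sum-choose2-classSize : ∀ {n m} (cl : Fin n → Fin m) →
  sum (choose2 ∘ classSize cl) ≡ pairsWith (λ u v → ⌊ cl v ≟ cl u ⌋)
sum-choose2-classSize {zero}  {m} cl = sum-replicate-zero m
sum-choose2-classSize {suc n}     cl = begin
  sum (λ j → choose2 (indicator (cl Fin.zero) j + classSize (cl ∘ Fin.suc) j))
    ≡⟨ sum-choose2-bump (cl Fin.zero) (classSize (cl ∘ Fin.suc)) ⟩
  sum (choose2 ∘ classSize (cl ∘ Fin.suc)) + classSize (cl ∘ Fin.suc) (cl Fin.zero)
    ≡⟨ cong (_+ classSize (cl ∘ Fin.suc) (cl Fin.zero)) (sum-choose2-classSize (cl ∘ Fin.suc)) ⟩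
  pairsWith (λ u v → ⌊ cl (Fin.suc v) ≟ cl (Fin.suc u) ⌋) + classSize (cl ∘ Fin.suc) (cl Fin.zero)
    ≡⟨ +-comm (pairsWith (λ u v → ⌊ cl (Fin.suc v) ≟ cl (Fin.suc u) ⌋)) _ ⟩
  classSize (cl ∘ Fin.suc) (cl Fin.zero) + pairsWith (λ u v → ⌊ cl (Fin.suc v) ≟ cl (Fin.suc u) ⌋)
    ≡⟨ ≡.sym (pairsWith-suc (λ u v → ⌊ cl v ≟ cl u ⌋)) ⟩
  pairsWith (λ u v → ⌊ cl v ≟ cl u ⌋)
    ∎
  where open ≡.≡-Reasoning

sum-choose2-classSize≤pairsWith : ∀ {n m} (cl : Fin n → Fin m) {c : Fin n → Fin n → Bool} →
  (∀ u v → cl u ≡ cl v → T (c u v)) → sum (choose2 ∘ classSize cl) ≤ pairsWith c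
sum-choose2-classSize≤pairsWith cl same⇒c = ≤-trans
  (≤-reflexive (sum-choose2-classSize cl))
  (pairsWith-mono λ u v same → same⇒c u v (≡.sym (toWitness same)))

locate : ∀ {m} (b : Fin (suc m) → ℕ) {d} → b Fin.zero ≤ d → d < b (fromℕ m) →
  ∃[ j ] (b (inject₁ j) ≤ d × d < b (Fin.suc j))
locate {zero}  b b₀≤d d<bₘ = ⊥-elim (<⇒≱ d<bₘ b₀≤d)
locate {suc m} b {d} b₀≤d d<bₘ with d <? b (Fin.suc Fin.zero)
... | yes d<b₁ = Fin.zero , b₀≤d , d<b₁
... | no  d≮b₁ with locate (b ∘ Fin.suc) (≮⇒≥ d≮b₁) d<bₘ
...   | j , in-j = Fin.suc j , in-j

∣m-n∣<c∸a : ∀ {a c m n} → a ≤ m → m < c → a ≤ n → n < c → ∣ m - n ∣ < c ∸ a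
∣m-n∣<c∸a {a} {c} {m} {n} a≤m m<c a≤n n<c = begin-strict
  ∣ m - n ∣                      ≡⟨ cong₂ ∣_-_∣ (≡.sym (m+[n∸m]≡n a≤m)) (≡.sym (m+[n∸m]≡n a≤n)) ⟩
  ∣ a + (m ∸ a) - a + (n ∸ a) ∣  ≡⟨ ∣m+n-m+o∣≡∣n-o∣ a (m ∸ a) (n ∸ a) ⟩
  ∣ m ∸ a - n ∸ a ∣              ≤⟨ ∣m-n∣≤m⊔n (m ∸ a) (n ∸ a) ⟩
  (m ∸ a) ⊔ (n ∸ a)              <⟨ ⊔-lub (∸-monoˡ-< m<c a≤m) (∸-monoˡ-< n<c a≤n) ⟩
  c ∸ a                          ∎
  where open ≤-Reasoning

module DegreeClasses {n m} (G : Graph n) (b : Fin (suc m) → ℕ)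
                    (b₀≡0 : b Fin.zero ≡ 0) (bₘ≡n : b (fromℕ m) ≡ n) where

  Interval : Fin m → ℕ → Set
  Interval j d = b (inject₁ j) ≤ d × d < b (Fin.suc j)

  located : ∀ v → ∃[ j ] Interval j (degree G v)
  located v = locate b (subst (_≤ degree G v) (≡.sym b₀≡0) z≤n)
                       (subst (degree G v <_) (≡.sym bₘ≡n) (degree<n G v))

  degreeClass : Fin n → Fin m
  degreeClass v = proj₁ (located v)

  Interval-degreeClass : ∀ {j} v → degreeClass v ≡ j → Interval j (degree G v)
  Interval-degreeClass v refl = proj₂ (located v)

  degreeClass-close : ∀ {k} → (∀ j → b (Fin.suc j) ∸ b (inject₁ j) ≤ k) →
    ∀ u v → degreeClass u ≡ degreeClass v → T ⌊ ∣ degree G u - degree G v ∣ <? k ⌋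
  degreeClass-close width u v same = fromWitness (<-≤-trans
    (∣m-n∣<c∸a (proj₁ in-u) (proj₂ in-u) (proj₁ in-v) (proj₂ in-v)) (width (degreeClass u)))
    where
    in-u : Interval (degreeClass u) (degree G u)
    in-u = Interval-degreeClass u refl
    in-v : Interval (degreeClass u) (degree G v)
    in-v = Interval-degreeClass v (≡.sym same)

  classSize-degreeClass≤ : ∀ j →
    classSize degreeClass j ≤
      count (λ v → ⌊ b (inject₁ j) ≤? degree G v ⌋ ∧ ⌊ degree G v <? b (Fin.suc j) ⌋)
  classSize-degreeClass≤ j = count-mono λ v same →
    Equivalence.from (T-∧ {x = ⌊ b (inject₁ j) ≤? degree G v ⌋})
      (fromWitness (proj₁ (in-j v same)) , fromWitness (proj₂ (in-j v same)))
    where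
    in-j : ∀ v → T ⌊ degreeClass v ≟ j ⌋ → Interval j (degree G v)
    in-j v same = Interval-degreeClass v (toWitness same)

lemma2 : (n k : ℕ) → .{{_ : NonZero k}} → k < n →
    (i t : ℕ) → 1 ≤ i → 1 ≤ t → t ≤ k → n ≡ k * i + t →
    (G : Graph n) → h k G < f0 n k →
    (b : Fin (suc (suc i)) → ℕ) →
    b Fin.zero ≡ 0 → b (fromℕ (suc i)) ≡ n →
    (∀ (j : Fin (suc i)) → b (inject₁ j) < b (Fin.suc j)) →
    (∀ (j : Fin (suc i)) → b (Fin.suc j) ∸ b (inject₁ j) ≤ k) →
    ∀ (j : Fin (suc i)) →
      t ≤ count (λ v → ⌊ b (inject₁ j) ≤? degree G v ⌋ ∧ ⌊ degree G v <? b (Fin.suc j) ⌋)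
lemma2 n (suc k) _ (suc i) (suc t) _ _ t<k refl G h<f0 b b₀≡0 bₗ≡n _ width J =
  ≮⇒≥ λ few → <⇒≱ h<f0 (begin
    f0 n (suc k)
      ≡⟨ f0-closed k i t t<k ⟩
    suc i * choose2 (suc k) + suc k + choose2 t
      ≤⟨ f0-closed≤choose2[s]+Y (suc k) (suc i) t (N J) _ _
           (≤-trans (classSize-degreeClass≤ J) (≤-pred few)) t<k N-total
           (k*sum≤sum-choose2+m*choose2[1+k] (suc k) (removeAt N J)) ⟩
    choose2 (N J) + sum (removeAt (choose2 ∘ N) J)
      ≡⟨ ≡.sym (sum-remove {i = J} (choose2 ∘ N)) ⟩
    sum (choose2 ∘ N)
      ≤⟨ sum-choose2-classSize≤pairsWith degreeClass (degreeClass-close width) ⟩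
    pairsWith (λ u v → ⌊ ∣ degree G u - degree G v ∣ <? suc k ⌋)
      ≡⟨ ≡.sym (h≡pairsWith (suc k) G) ⟩
    h (suc k) G
      ∎)
  where
  open ≤-Reasoning
  open DegreeClasses G b b₀≡0 bₗ≡n
  N : Fin (suc (suc i)) → ℕ
  N = classSize degreeClass
  N-total : N J + sum (removeAt N J) ≡ suc k * suc i + suc t
  N-total = trans (≡.sym (sum-remove {i = J} N)) (sum-classSize degreeClass)
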